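{- Let $(\Sigma, I, \to, \preceq)$ be a well-structured transition system and let $P \subseteq \Sigma$ be a downward-closed set. If the rule system described in the context admits a derivation $\mathsf{Init} \mapsto^{*} \mathsf{invalid}$, then $\mathrm{Cover} \not\subseteq P$.
   Context: A well-structured transition system (WSTS) $(\Sigma, I, \to, \preceq)$ consists of a set $\Sigma$ of states, a finite set $I \subseteq \Sigma$ of initial states, a relation $\to \subseteq \Sigma \times \Sigma$, and a well-quasi-order $\preceq$ on $\Sigma$ such that whenever $s_1 \to s_2$ and $s_1 \preceq t_1$, there is $t_2$ with $t_1 \to^{*} t_2$ and $s_2 \preceq t_2$. For $Y \subseteq \Sigma$, $\uparrow Y = \{x \mid \exists y \in Y,\ y \preceq x\}$ and $\downarrow Y = \{x \mid \exists y \in Y,\ x \preceq y\}$; $\uparrow x = \uparrow\{x\}$. For $X \subseteq \Sigma$, $\mathrm{pre}(X) = \{y \mid \exists x \in X,\ y \to x\}$. $\mathrm{Reach}$ is the set of states reachable from $I$ via $\to^{*}$, and $\mathrm{Cover} = \downarrow \mathrm{Reach}$. The rule system (generic version). Its states are $\mathsf{Init}$, $\mathsf{valid}$, $\mathsf{invalid}$, and pairs $\mathbf{R} \mid Q$ where $\mathbf{R} = (R_0, \ldots, R_N)$ ($N \ge 0$, called the length) is a vector of downward-closed subsets of $\Sigma$ and $Q$ is a finite priority queue of pairs $\langle a, i\rangle \in \Sigma \times \mathbb{N}$ with priority $i$; $\min Q$ is an element of least priority, $\mathrm{popMin}(Q)$ is $Q$ with that element removed, $\mathrm{push}(Q,x)$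 is $Q$ with $x$ added. For $0 \le i \le N$ and $a \in \Sigma$ let $\mathrm{Gen}_i(a) = \{ b \mid b \preceq a,\ \uparrow b \cap I = \emptyset,\ \mathrm{pre}(\uparrow b) \cap (R_i \setminus \uparrow b) = \emptyset\}$. $\mathbf{R}[R_k \gets R'_k]_{k=1}^i$ denotes $(R_0, R'_1, \ldots, R'_i, R_{i+1}, \ldots, R_N)$. The one-step relation $\mapsto$ is given by the rules: (Initialize) $\mathsf{Init} \mapsto (\downarrow I) \mid \emptyset$ (a vector of length $0$ with $R_0 = \downarrow I$). (CandidateNondet) if $a \in R_N \setminus P$: $\mathbf{R} \mid \emptyset \mapsto \mathbf{R} \mid \{\langle a, N\rangle\}$. (ModelSyn) if $\min Q = \langle a, 0\rangle$: $\mathbf{R}\mid Q \mapsto \mathsf{invalid}$. (ModelSem) if $\min Q = \langle a, i\rangle$ and $I \cap \uparrow a \neq \emptyset$: $\mathbf{R}\mid Q \mapsto \mathsf{invalid}$. (DecideNondet) if $\min Q = \langle a, i \rangle$, $i > 0$, $b \in \mathrm{pre}(\uparrow a) \cap (R_{i-1} \setminus \uparrow a)$: $\mathbf{R}\mid Q \mapsto \mathbf{R} \mid \mathrm{push}(Q, \langle b, i-1\rangle)$. (Conflict) if $\min Q = \langle a, i\rangle$, $i>0$, $\mathrm{pre}(\uparrow a) \cap (R_{i-1}\setminus \uparrow a) = \emptyset$ and $b \in \mathrm{Gen}_{i-1}(a)$: $\mathbf{R}\mid Q \mapsto \mathbf{R}[R_k \gets R_k \setminus \uparrow b]_{k=1}^{i}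 \mid \mathrm{popMin}(Q)$. (Induction) if $R_i = \Sigma \setminus \uparrow\{r_{i,1}, \ldots, r_{i,m}\}$ and $b \in \mathrm{Gen}_i(r_{i,j})$ for some $1 \le j \le m$: $\mathbf{R} \mid \emptyset \mapsto \mathbf{R}[R_k \gets R_k \setminus \uparrow b]_{k=1}^{i+1} \mid \emptyset$. (Valid) if $R_i = R_{i+1}$ for some $i < N$: $\mathbf{R}\mid Q \mapsto \mathsf{valid}$. (Unfold) if $R_N \subseteq P$: $\mathbf{R} \mid \emptyset \mapsto (R_0, \ldots, R_N, \Sigma) \mid \emptyset$. $\mapsto^{*}$ is the reflexive-transitive closure of $\mapsto$. -}

module Defs where

open import Level using (0ℓ)
open import Data.Nat using (ℕ; zero; suc; _≤_; _<_; _≤ᵇ_; _≡ᵇ_)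
open import Data.Bool using (if_then_else_; _∧_)
open import Data.Product using (Σ; ∃; ∃₂; _×_; _,_; proj₂)
open import Data.List using (List; []; _∷_; _++_)
open import Data.List.Relation.Unary.Any using (Any)
open import Data.List.Relation.Unary.All using (All)
open import Relation.Binary using (Rel; IsPreorder)
open import Relation.Binary.PropositionalEquality using (_≡_)
open import Relation.Binary.Construct.Closure.ReflexiveTransitive using (Star)
open import Relation.Unary using (Pred; _∈_; _∉_; _⊆_; _≐_; _∩_; _∖_; ∁; Empty; U)

record IsWQO {S : Set} (_⪯_ : Rel S 0ℓ) : Set where
  field
    isPreorder : IsPreorder _≡_ _⪯_
    good       : (f : ℕ → S) → ∃₂ λ i j → i < j × f i ⪯ f j

record WSTS : Set₁ where
  field
    St      : Set
    I       : List St
    _⟶_     : Rel St 0ℓ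
    _⪯_     : Rel St 0ℓ
    isWQO   : IsWQO _⪯_
    compat  : ∀ {s₁ s₂ t₁} → s₁ ⟶ s₂ → s₁ ⪯ t₁ →
              ∃ λ t₂ → Star _⟶_ t₁ t₂ × s₂ ⪯ t₂

  InI : Pred St 0ℓ
  InI x = Any (x ≡_) I

  ↑ : St → Pred St 0ℓ
  ↑ b x = b ⪯ x

  ↑L : List St → Pred St 0ℓ
  ↑L ys x = Any (_⪯ x) ys

  ↓ : Pred St 0ℓ → Pred St 0ℓ
  ↓ Y x = ∃ λ y → Y y × x ⪯ y

  DownClosed : Pred St 0ℓ → Set
  DownClosed X = ∀ {x y} → y ⪯ x → X x → X y

  pre : Pred St 0ℓ → Pred St 0ℓ
  pre X y = ∃ λ x → X x × y ⟶ x

  Reach : Pred St 0ℓ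
  Reach x = ∃ λ i → InI i × Star _⟶_ i x

  Cover : Pred St 0ℓ
  Cover = ↓ Reach

module RuleSystem (W : WSTS) (P : Pred (WSTS.St W) 0ℓ) where
  open WSTS W

  -- Frame vectors (R₀,…,R_N) are represented as functions ℕ → Pred St
  -- together with the length N; entries beyond N are never inspected.
  Frames : Set₁
  Frames = ℕ → Pred St 0ℓ

  Entry : Set
  Entry = St × ℕ

  data RState : Set₁ where
    Init    : RState
    valid   : RState
    invalid : RState
    frames  : (N : ℕ) → Frames → List Entry → RState

  Gen : Frames → ℕ → St → Pred St 0ℓ
  Gen R i a b = (b ⪯ a) × Empty (↑ b ∩ InI) × Empty (pre (↑ b) ∩ (R i ∖ ↑ b))

  upd : Frames → ℕ → St → Frames
  upd R i b k = if (1 ≤ᵇ k) ∧ (k ≤ᵇ i) then (R k ∖ ↑ b) else R k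

  extend : Frames → ℕ → Frames
  extend R N k = if k ≡ᵇ suc N then U else R k

  initFrames : Frames
  initFrames k = if k ≡ᵇ 0 then ↓ InI else U

  -- "min Q = ⟨a,i⟩" is expressed by writing Q = Q₁ ++ ⟨a,i⟩ ∷ Q₂ where all
  -- other entries have priority ≥ i; then popMin(Q) = Q₁ ++ Q₂ and
  -- push(Q,x) = x ∷ Q.
  MinRest : ℕ → List Entry → List Entry → Set
  MinRest i Q₁ Q₂ = All (λ e → i ≤ proj₂ e) (Q₁ ++ Q₂)

  data _↦_ : RState → RState → Set₁ where
    initialize : Init ↦ frames 0 initFrames []
    candidateNondet : ∀ {N R a} → a ∈ (R N ∖ P) →
      frames N R [] ↦ frames N R ((a , N) ∷ [])
    modelSyn : ∀ {N R a Q₁ Q₂} → MinRest 0 Q₁ Q₂ →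
      frames N R (Q₁ ++ (a , 0) ∷ Q₂) ↦ invalid
    modelSem : ∀ {N R a i Q₁ Q₂} → MinRest i Q₁ Q₂ → Any (a ⪯_) I →
      frames N R (Q₁ ++ (a , i) ∷ Q₂) ↦ invalid
    decideNondet : ∀ {N R a j b Q₁ Q₂} → MinRest (suc j) Q₁ Q₂ → suc j ≤ N →
      b ∈ (pre (↑ a) ∩ (R j ∖ ↑ a)) →
      frames N R (Q₁ ++ (a , suc j) ∷ Q₂)
        ↦ frames N R ((b , j) ∷ (Q₁ ++ (a , suc j) ∷ Q₂))
    conflict : ∀ {N R a j b Q₁ Q₂} → MinRest (suc j) Q₁ Q₂ → suc j ≤ N →
      Empty (pre (↑ a) ∩ (R j ∖ ↑ a)) → b ∈ Gen R j a →
      frames N R (Q₁ ++ (a , suc j) ∷ Q₂) ↦ frames N (upd R (suc j) b) (Q₁ ++ Q₂)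
    induction : ∀ {N R i rs r b} → i < N → R i ≐ ∁ (↑L rs) →
      Any (r ≡_) rs → b ∈ Gen R i r →
      frames N R [] ↦ frames N (upd R (suc i) b) []
    valid-rule : ∀ {N R Q i} → i < N → R i ≐ R (suc i) →
      frames N R Q ↦ valid
    unfold : ∀ {N R} → R N ⊆ P →
      frames N R [] ↦ frames (suc N) (extend R N) []

  _↦*_ : RState → RState → Set₁
  _↦*_ = Star _↦_

module Submission where

open import Defs
open import Level using (0ℓ)
open import Data.Empty using (⊥)
open import Data.Unit using (⊤; tt)
open import Data.Product using (∃; _×_; _,_)
open import Data.List using ([]; _∷_; _++_)
open import Data.List.Relation.Unary.All using (All; []; _∷_)
open import Data.List.Relation.Unary.All.Properties using (++⁻; ++⁺)
open import Data.List.Membership.Propositional using (find)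
open import Relation.Binary using (IsPreorder)
open import Relation.Binary.PropositionalEquality using (_≡_; refl)
open import Relation.Binary.Construct.Closure.ReflexiveTransitive using (Star; ε; _◅_; _◅◅_)
open import Relation.Nullary using (¬_)
open import Relation.Unary using (Pred; _∉_; _⊆_)

-- Every obligation ⟨a , i⟩ in the queue is a state from which some state
-- outside P is reachable, and obligations of priority 0 lie in R₀ ⊆ ↓I.
-- Deriving invalid therefore exhibits such an obligation below an initial
-- state; by compatibility of ⪯ with ⟶ an initial state then also reaches a
-- state outside P, which lies in Cover.

All-middle : ∀ {A : Set} {Q : Pred A 0ℓ} xs {x ys} → All Q (xs ++ x ∷ ys) → Q x
All-middle xs qs with ++⁻ xs qs
... | _ , (qx ∷ _) = qx

All-removeMiddle : ∀ {A : Set} {Q : Pred A 0ℓ} xs {x ys} →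
  All Q (xs ++ x ∷ ys) → All Q (xs ++ ys)
All-removeMiddle xs qs with ++⁻ xs qs
... | qxs , (_ ∷ qys) = ++⁺ qxs qys

module _ (W : WSTS) where
  open WSTS W

  ⪯-refl : ∀ {x} → x ⪯ x
  ⪯-refl = IsPreorder.refl (IsWQO.isPreorder isWQO)

  compat* : ∀ {s₁ s₂ t₁} → Star _⟶_ s₁ s₂ → s₁ ⪯ t₁ →
            ∃ λ t₂ → Star _⟶_ t₁ t₂ × s₂ ⪯ t₂
  compat* ε s₁⪯t₁ = _ , ε , s₁⪯t₁
  compat* (s₁⟶s ◅ s⟶*s₂) s₁⪯t₁ with compat s₁⟶s s₁⪯t₁
  ... | t , t₁⟶*t , s⪯t with compat* s⟶*s₂ s⪯t
  ...   | t₂ , t⟶*t₂ , s₂⪯t₂ = t₂ , t₁⟶*t ◅◅ t⟶*t₂ , s₂⪯t₂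

  Escapes : Pred St 0ℓ → Pred St 0ℓ
  Escapes P a = ∃ λ c → Star _⟶_ a c × c ∉ P

  escapes-pre : ∀ {P a b} → b ⟶ a → Escapes P a → Escapes P b
  escapes-pre b⟶a (c , a⟶*c , c∉P) = c , b⟶a ◅ a⟶*c , c∉P

  escapes-upward : ∀ {P a t} → DownClosed P → a ⪯ t → Escapes P a → Escapes P t
  escapes-upward dc a⪯t (c , a⟶*c , c∉P) with compat* a⟶*c a⪯t
  ... | d , t⟶*d , c⪯d = d , t⟶*d , λ d∈P → c∉P (dc c⪯d d∈P)

  cover⊆⇒↓I-not-escapes : ∀ {P a} → DownClosed P → Cover ⊆ P → ↓ InI a → ¬ Escapes P a
  cover⊆⇒↓I-not-escapes dc cover⊆P (y , y∈I , a⪯y) escapes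
    with escapes-upward dc a⪯y escapes
  ... | c , y⟶*c , c∉P = c∉P (cover⊆P (c , (y , y∈I , y⟶*c) , ⪯-refl))

module Soundness (W : WSTS) (P : Pred (WSTS.St W) 0ℓ) (dc : WSTS.DownClosed W P)
                 (cover⊆P : WSTS.Cover W ⊆ P) where
  open WSTS W
  open RuleSystem W P

  SoundEntry : Pred St 0ℓ → Entry → Set
  SoundEntry R₀ (a , i) = Escapes W P a × (i ≡ 0 → R₀ a)

  Invariant : RState → Set
  Invariant Init            = ⊤
  Invariant valid           = ⊤
  Invariant invalid         = ⊥
  Invariant (frames _ R Q) = R 0 ⊆ ↓ InI × All (SoundEntry (R 0)) Q

  ↓I-not-escapes : ∀ {a} → ↓ InI a → ¬ Escapes W P a
  ↓I-not-escapes = cover⊆⇒↓I-not-escapes W dc cover⊆P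

  -- upd and extend leave R 0 definitionally unchanged, so R₀ ⊆ ↓I is carried along as is.
  preserved : ∀ {s t} → s ↦ t → Invariant s → Invariant t
  preserved initialize _ = (λ a∈↓I → a∈↓I) , []
  preserved (candidateNondet (a∈R , a∉P)) (R₀⊆↓I , _) =
    R₀⊆↓I , ((_ , ε , a∉P) , λ { refl → a∈R }) ∷ []
  preserved (modelSyn {Q₁ = Q₁} _) (R₀⊆↓I , sound)
    with All-middle Q₁ sound
  ... | escapes , a∈R₀ = ↓I-not-escapes (R₀⊆↓I (a∈R₀ refl)) escapes
  preserved (modelSem {Q₁ = Q₁} _ a⪯I) (_ , sound)
    with All-middle Q₁ sound | find a⪯I
  ... | escapes , _ | y , y∈I , a⪯y = ↓I-not-escapes (y , y∈I , a⪯y) escapes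
  preserved (decideNondet {Q₁ = Q₁} _ _ ((x , a⪯x , b⟶x) , b∈R , _)) (R₀⊆↓I , sound)
    with All-middle Q₁ sound
  ... | escapes , _ =
    R₀⊆↓I , (escapes-pre W b⟶x (escapes-upward W dc a⪯x escapes) , λ { refl → b∈R }) ∷ sound
  preserved (conflict {Q₁ = Q₁} _ _ _ _) (R₀⊆↓I , sound) =
    R₀⊆↓I , All-removeMiddle Q₁ sound
  preserved (induction _ _ _ _) inv = inv
  preserved (valid-rule _ _) _ = tt
  preserved (unfold _) inv = inv

  preserved* : ∀ {s t} → s ↦* t → Invariant s → Invariant t
  preserved* ε inv = inv
  preserved* (step ◅ steps) inv = preserved* steps (preserved step inv)

theorem2 : (W : WSTS) → (P : Pred (WSTS.St W) 0ℓ) → WSTS.DownClosed W P →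
    RuleSystem._↦*_ W P (RuleSystem.Init {W} {P}) (RuleSystem.invalid {W} {P}) →
    ¬ (WSTS.Cover W ⊆ P)
theorem2 W P dc run cover⊆P = Soundness.preserved* W P dc cover⊆P run tt
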